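{- For all integers $m\ge 2$ and $n>2m$, $$b(C(n;1,2,\dots,m)) = \left\lceil \frac{(m-1)+\sqrt{4mn+(m-1)^2}}{2m}\right\rceil.$$
   Context: For an integer $n$ and positive integers $s_1<\dots<s_t\le n/2$, the circulant graph $C(n;s_1,\dots,s_t)$ has vertex set $\mathbb Z_n$, with distinct vertices $x,y$ adjacent iff $x-y \equiv \pm s_i \pmod n$ for some $i$. For a finite connected graph $G$, let $N_\ell[x]=\{y: d(x,y)\le \ell\}$. A sequence of vertices $(x_1,\dots,x_k)$ is a burning sequence of $G$ if $N_{k-1}[x_1]\cup N_{k-2}[x_2]\cup\cdots\cup N_0[x_k]=V(G)$; the burning number $b(G)$ is the minimum length of a burning sequence of $G$. -}

module Defs where

open import Data.Nat using (ℕ; zero; suc; _∸_; _≤_; _<_)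
open import Data.Fin using (Fin; toℕ)
open import Data.Integer as ℤ using (ℤ; +_)
open import Data.Integer.Divisibility using (_∣_)
open import Data.List using (List; map; upTo)
open import Data.List.Membership.Propositional using (_∈_)
open import Data.Product using (Σ; ∃; ∃-syntax; _×_; _,_)
open import Data.Sum using (_⊎_)
open import Relation.Binary.PropositionalEquality using (_≡_; _≢_)

Graph : ℕ → Set₁
Graph n = Fin n → Fin n → Set

circulant : (n : ℕ) → List ℕ → Graph n
circulant n S x y =
  (x ≢ y) ×
  (∃[ s ] (s ∈ S) ×
     ((+ n ∣ ((+ toℕ x ℤ.- + toℕ y) ℤ.- + s)) ⊎ (+ n ∣ ((+ toℕ x ℤ.- + toℕ y) ℤ.+ + s))))

oneTo : ℕ → List ℕ
oneTo m = map suc (upTo m)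

-- Within G ℓ x y  ⇔  d_G(x, y) ≤ ℓ  (there is a walk of length ≤ ℓ from x to y),
-- i.e. y ∈ N_ℓ[x].
data Within {n : ℕ} (G : Graph n) : ℕ → Fin n → Fin n → Set where
  here  : ∀ {ℓ x} → Within G ℓ x x
  step  : ∀ {ℓ x z y} → G x z → Within G ℓ z y → Within G (suc ℓ) x y

-- (x_1, ..., x_k) (0-indexed as xs 0, ..., xs (k-1)) is a burning sequence:
-- N_{k-1}[x_1] ∪ ... ∪ N_0[x_k] = V(G).
IsBurningSeq : {n : ℕ} → Graph n → (k : ℕ) → (Fin k → Fin n) → Set
IsBurningSeq {n} G k xs = ∀ (v : Fin n) → ∃[ i ] Within G (k ∸ suc (toℕ i)) (xs i) v

IsBurningNumber : {n : ℕ} → Graph n → ℕ → Set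
IsBurningNumber G b =
  (Σ (Fin b → _) λ xs → IsBurningSeq G b xs) ×
  (∀ k (xs : Fin k → _) → IsBurningSeq G k xs → b ≤ k)

-- Comparisons of an integer with √D (D ≥ 0), stated without reals:
--   a ≤ √D  ⇔  a ≤ 0 or a² ≤ D ;   √D ≤ a  ⇔  0 ≤ a and D ≤ a² ;
--   a < √D  ⇔  a < 0 or a² < D .
sqrtLe : ℤ → ℤ → Set        -- sqrtLe D a : √D ≤ a
sqrtLe D a = (+ 0 ℤ.≤ a) × (D ℤ.≤ a ℤ.* a)

ltSqrt : ℤ → ℤ → Set        -- ltSqrt a D : a < √D
ltSqrt a D = (a ℤ.< + 0) ⊎ (a ℤ.* a ℤ.< D)

-- IsCeilFormula m n k : k = ⌈ ((m-1) + √(4mn + (m-1)²)) / (2m) ⌉  (m ≥ 1),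
-- i.e.  k - 1 < ((m-1) + √D)/(2m) ≤ k, with D = 4mn + (m-1)², multiplied out by 2m > 0:
--   2m(k-1) - (m-1) < √D  and  √D ≤ 2mk - (m-1).
IsCeilFormula : ℕ → ℕ → ℤ → Set
IsCeilFormula m n k =
  ltSqrt (+ (2 Data.Nat.* m) ℤ.* (k ℤ.- + 1) ℤ.- + (m ∸ 1)) D ×
  sqrtLe D (+ (2 Data.Nat.* m) ℤ.* k ℤ.- + (m ∸ 1))
  where
  D : ℤ
  D = + (4 Data.Nat.* m Data.Nat.* n) ℤ.+ + (m ∸ 1) ℤ.* + (m ∸ 1)

-- A ball of radius r in C(n; 1, …, m) is an arc of at most 2mr + 1 consecutive residues:
-- each edge moves by at most m, so the end of a walk of length r from x is congruent to
-- x + d with |d| ≤ mr. Hence k sources burn at most F(k) = Σ_{r<k} (2mr + 1) vertices,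
-- and when m < n the balls of radius r around F(r) + mr, r < k, tile [0, F(k)), so the
-- burning number is the least k with n ≤ F(k). Since F(k) = mk² − (m − 1)k, we have
-- 4m·F(k) + (m − 1)² = (2mk − (m − 1))², which turns that least k into the ceiling.

module Submission where

open import Defs
open import Data.Nat using (ℕ; _≤_; _<_; _*_)
open import Data.Integer using (+_)
open import Data.Product using (∃-syntax; _×_; _,_; proj₁; proj₂)

open import Data.Nat.Base using (zero; suc; _+_; _∸_; ∣_-_∣; z≤n; s≤s; s≤s⁻¹; z<s; NonZero; >-nonZero; >-nonZero⁻¹)
open import Data.Nat.Properties
open import Data.Nat.DivMod
  using (_%_; _/_; _mod_; m≡m%n+[m/n]*n; %-congˡ; %-distribˡ-+; %-remove-+ʳ; m%n%n≡m%n; m<n⇒m%n≡m)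
open import Data.Nat.Divisibility using (_∣_; divides; ∣⇒≤)
import Data.Nat.Tactic.RingSolver as ℕ-Solver
import Data.Integer as ℤ
import Data.Integer.Properties as ℤₚ
open import Data.Integer.Divisibility using () renaming (_∣_ to _∣ℤ_)
import Data.Integer.Tactic.RingSolver as ℤ-Solver
open import Data.Fin using (Fin; toℕ; fromℕ<; opposite)
open import Data.Fin.Properties
  using (toℕ-fromℕ<; toℕ-injective; toℕ<n; opposite-prop; opposite-involutive; injective⇒≤)
open import Data.List using (List)
open import Data.List.Membership.Propositional using (_∈_)
open import Data.List.Membership.Propositional.Properties using (∈-map⁺; ∈-map⁻; ∈-upTo⁺; ∈-upTo⁻)
open import Data.Sum using (_⊎_; inj₁; inj₂)
open import Relation.Nullary using (yes; no; contradiction)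
open import Relation.Binary.Definitions using (Symmetric; tri<; tri≈; tri>)
open import Relation.Binary.PropositionalEquality

∣+a-+b∣≡∣a-b∣ : ∀ a b → ℤ.∣ + a ℤ.- + b ∣ ≡ ∣ a - b ∣
∣+a-+b∣≡∣a-b∣ a b with ≤-total a b
... | inj₁ a≤b = trans (cong ℤ.∣_∣ (ℤₚ.m-n≡m⊖n a b)) (trans (ℤₚ.∣⊖∣-≤ a≤b) (sym (m≤n⇒∣m-n∣≡n∸m a≤b)))
... | inj₂ b≤a = trans (cong ℤ.∣_∣ (trans (ℤₚ.m-n≡m⊖n a b) (ℤₚ.⊖-≥ b≤a))) (sym (m≤n⇒∣n-m∣≡n∸m b≤a))

module _ {n : ℕ} .{{_ : NonZero n}} where

  %≡⇒∣∸ : ∀ {a b} → a % n ≡ b % n → n ∣ a ∸ b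
  %≡⇒∣∸ {a} {b} eq = divides (a / n ∸ b / n) (begin
    a ∸ b                                     ≡⟨ cong₂ _∸_ (m≡m%n+[m/n]*n a n) (m≡m%n+[m/n]*n b n) ⟩
    (a % n + a / n * n) ∸ (b % n + b / n * n) ≡⟨ cong (λ r → (r + a / n * n) ∸ (b % n + b / n * n)) eq ⟩
    (b % n + a / n * n) ∸ (b % n + b / n * n) ≡⟨ [m+n]∸[m+o]≡n∸o (b % n) _ _ ⟩
    a / n * n ∸ b / n * n                     ≡⟨ *-distribʳ-∸ n (a / n) (b / n) ⟨
    (a / n ∸ b / n) * n                       ∎)
    where open ≡-Reasoning

  ∣∸⇒%≡ : ∀ {a b} → b ≤ a → n ∣ a ∸ b → a % n ≡ b % n
  ∣∸⇒%≡ {a} {b} b≤a n∣a∸b = trans (%-congˡ (sym (m+[n∸m]≡n b≤a))) (%-remove-+ʳ b n∣a∸b)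

  %≡⇒∣∣-∣ : ∀ {a b} → a % n ≡ b % n → n ∣ ∣ a - b ∣
  %≡⇒∣∣-∣ {a} {b} eq with ≤-total a b
  ... | inj₁ a≤b = subst (n ∣_) (sym (m≤n⇒∣m-n∣≡n∸m a≤b)) (%≡⇒∣∸ (sym eq))
  ... | inj₂ b≤a = subst (n ∣_) (sym (m≤n⇒∣n-m∣≡n∸m b≤a)) (%≡⇒∣∸ eq)

  ∣∣-∣⇒%≡ : ∀ {a b} → n ∣ ∣ a - b ∣ → a % n ≡ b % n
  ∣∣-∣⇒%≡ {a} {b} n∣ with ≤-total a b
  ... | inj₁ a≤b = sym (∣∸⇒%≡ a≤b (subst (n ∣_) (m≤n⇒∣m-n∣≡n∸m a≤b) n∣))
  ... | inj₂ b≤a = ∣∸⇒%≡ b≤a (subst (n ∣_) (m≤n⇒∣n-m∣≡n∸m b≤a) n∣)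

  ∣ℤ-⇒%≡ : ∀ a b → + n ∣ℤ + a ℤ.- + b → a % n ≡ b % n
  ∣ℤ-⇒%≡ a b n∣ = ∣∣-∣⇒%≡ (subst (n ∣_) (∣+a-+b∣≡∣a-b∣ a b) n∣)

  %≡⇒∣ℤ- : ∀ a b → a % n ≡ b % n → + n ∣ℤ + a ℤ.- + b
  %≡⇒∣ℤ- a b eq = subst (n ∣_) (sym (∣+a-+b∣≡∣a-b∣ a b)) (%≡⇒∣∣-∣ eq)

  %≡-+ʳ : ∀ {a b} c → a % n ≡ b % n → (a + c) % n ≡ (b + c) % n
  %≡-+ʳ {a} {b} c eq = begin
    (a + c) % n         ≡⟨ %-distribˡ-+ a c n ⟩
    (a % n + c % n) % n ≡⟨ cong (λ r → (r + c % n) % n) eq ⟩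
    (b % n + c % n) % n ≡⟨ %-distribˡ-+ b c n ⟨
    (b + c) % n         ∎
    where open ≡-Reasoning

  %≡-+ˡ : ∀ c {a b} → a % n ≡ b % n → (c + a) % n ≡ (c + b) % n
  %≡-+ˡ c {a} {b} eq = trans (%-congˡ (+-comm c a)) (trans (%≡-+ʳ c eq) (%-congˡ (+-comm b c)))

  %≡-cancelˡ-+ : ∀ c {a b} → (c + a) % n ≡ (c + b) % n → a % n ≡ b % n
  %≡-cancelˡ-+ c {a} {b} eq = ∣∣-∣⇒%≡ (subst (n ∣_) (∣m+n-m+o∣≡∣n-o∣ c a b) (%≡⇒∣∣-∣ eq))

  toℕ-mod : ∀ a → toℕ (a mod n) ≡ a % n
  toℕ-mod a = toℕ-fromℕ< _

  toℕ-%-injective : ∀ {v w : Fin n} → toℕ v % n ≡ toℕ w % n → v ≡ w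
  toℕ-%-injective {v} {w} eq =
    toℕ-injective (trans (sym (m<n⇒m%n≡m (toℕ<n v))) (trans eq (m<n⇒m%n≡m (toℕ<n w))))

  mod-toℕ : ∀ (v : Fin n) → toℕ v mod n ≡ v
  mod-toℕ v = toℕ-%-injective (trans (cong (_% n) (toℕ-mod (toℕ v))) (m%n%n≡m%n (toℕ v) n))

∣i-j-k∣≡∣j-i+k∣ : ∀ i j k → ℤ.∣ i ℤ.- j ℤ.- k ∣ ≡ ℤ.∣ j ℤ.- i ℤ.+ k ∣
∣i-j-k∣≡∣j-i+k∣ i j k = trans (sym (ℤₚ.∣-i∣≡∣i∣ (i ℤ.- j ℤ.- k))) (cong ℤ.∣_∣ (-[i-j-k]≡j-i+k i j k))
  where
  -[i-j-k]≡j-i+k : ∀ i j k → ℤ.- (i ℤ.- j ℤ.- k) ≡ j ℤ.- i ℤ.+ k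
  -[i-j-k]≡j-i+k = ℤ-Solver.solve-∀

+a-+b-+c≡+a-+[b+c] : ∀ a b c → + a ℤ.- + b ℤ.- + c ≡ + a ℤ.- + (b + c)
+a-+b-+c≡+a-+[b+c] a b c = trans (i-j-k≡i-[j+k] (+ a) (+ b) (+ c)) (cong (λ t → + a ℤ.- t) (sym (ℤₚ.pos-+ b c)))
  where
  i-j-k≡i-[j+k] : ∀ i j k → i ℤ.- j ℤ.- k ≡ i ℤ.- (j ℤ.+ k)
  i-j-k≡i-[j+k] = ℤ-Solver.solve-∀

+a-+b++c≡+[a+c]-+b : ∀ a b c → + a ℤ.- + b ℤ.+ + c ≡ + (a + c) ℤ.- + b
+a-+b++c≡+[a+c]-+b a b c = trans (i-j+k≡i+k-j (+ a) (+ b) (+ c)) (cong (ℤ._- + b) (sym (ℤₚ.pos-+ a c)))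
  where
  i-j+k≡i+k-j : ∀ i j k → i ℤ.- j ℤ.+ k ≡ i ℤ.+ k ℤ.- j
  i-j+k≡i+k-j = ℤ-Solver.solve-∀

circulant-sym : ∀ {n S} → Symmetric (circulant n S)
circulant-sym {x = x} {y} (x≢y , s , s∈S , inj₁ n∣) =
  ≢-sym x≢y , s , s∈S , inj₂ (subst (_ ∣_) (∣i-j-k∣≡∣j-i+k∣ (+ toℕ x) (+ toℕ y) (+ s)) n∣)
circulant-sym {x = x} {y} (x≢y , s , s∈S , inj₂ n∣) =
  ≢-sym x≢y , s , s∈S , inj₁ (subst (_ ∣_) (sym (∣i-j-k∣≡∣j-i+k∣ (+ toℕ y) (+ toℕ x) (+ s))) n∣)

module _ {n : ℕ} .{{_ : NonZero n}} where

  circulant-edge : ∀ {S x z} → circulant n S x z →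
    ∃[ s ] s ∈ S × (toℕ x % n ≡ (toℕ z + s) % n ⊎ (toℕ x + s) % n ≡ toℕ z % n)
  circulant-edge {x = x} {z} (_ , s , s∈S , inj₁ n∣) =
    s , s∈S , inj₁ (∣ℤ-⇒%≡ (toℕ x) (toℕ z + s) (subst (n ∣_) (cong ℤ.∣_∣ (+a-+b-+c≡+a-+[b+c] (toℕ x) (toℕ z) s)) n∣))
  circulant-edge {x = x} {z} (_ , s , s∈S , inj₂ n∣) =
    s , s∈S , inj₂ (∣ℤ-⇒%≡ (toℕ x + s) (toℕ z) (subst (n ∣_) (cong ℤ.∣_∣ (+a-+b++c≡+[a+c]-+b (toℕ x) (toℕ z) s)) n∣))

  circulant-stride : ∀ {S s} a → s ∈ S → 0 < s → s < n → circulant n S (a mod n) ((a + s) mod n)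
  circulant-stride {s = s} a s∈S 0<s s<n = distinct , s , s∈S , inj₂ n∣
    where
    distinct : a mod n ≢ (a + s) mod n
    distinct eq = <⇒≱ s<n (∣⇒≤ {{>-nonZero 0<s}} (subst (n ∣_) (∣m-m+n∣≡n a s) n∣s))
      where
      n∣s : n ∣ ∣ a - a + s ∣
      n∣s = %≡⇒∣∣-∣ (trans (sym (toℕ-mod a)) (trans (cong toℕ eq) (toℕ-mod (a + s))))
    A B : ℕ
    A = toℕ (a mod n)
    B = toℕ ((a + s) mod n)
    A+s≡B : (A + s) % n ≡ B % n
    A+s≡B = begin
      (A + s) % n       ≡⟨ cong (λ r → (r + s) % n) (toℕ-mod a) ⟩
      (a % n + s) % n   ≡⟨ %≡-+ʳ s (m%n%n≡m%n a n) ⟩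
      (a + s) % n       ≡⟨ m%n%n≡m%n (a + s) n ⟨
      (a + s) % n % n   ≡⟨ cong (_% n) (toℕ-mod (a + s)) ⟨
      B % n             ∎
      where open ≡-Reasoning
    n∣ : + n ∣ℤ + A ℤ.- + B ℤ.+ + s
    n∣ = subst (n ∣_) (cong ℤ.∣_∣ (sym (+a-+b++c≡+[a+c]-+b A B s))) (%≡⇒∣ℤ- (A + s) B A+s≡B)

module _ {n : ℕ} {G : Graph n} where

  Within-snoc : ∀ {ℓ x y z} → Within G ℓ x y → G y z → Within G (suc ℓ) x z
  Within-snoc here       g′ = step g′ here
  Within-snoc (step g w) g′ = step g (Within-snoc w g′)

  Within-reverse : Symmetric G → ∀ {ℓ x y} → Within G ℓ x y → Within G ℓ y x
  Within-reverse G-sym here       = here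
  Within-reverse G-sym (step g w) = Within-snoc (Within-reverse G-sym w) (G-sym g)

  Within-stride : ∀ m .{{_ : NonZero m}} (f : ℕ → Fin n) →
    (∀ a s → 0 < s → s ≤ m → G (f a) (f (a + s))) →
    ∀ r a d → d ≤ m * r → Within G r (f a) (f (a + d))
  Within-stride m f edge r a zero _ = subst (λ b → Within G r (f a) (f b)) (sym (+-identityʳ a)) here
  Within-stride m f edge zero a (suc d) d<m*0 = contradiction (subst (suc d ≤_) (*-zeroʳ m) d<m*0) λ ()
  Within-stride m f edge (suc r) a (suc d) d<m*[1+r] with suc d ≤? m
  ... | yes d<m = step (edge a (suc d) z<s d<m) here
  ... | no d≮m = step (edge a m (>-nonZero⁻¹ m) ≤-refl)
                   (subst (λ b → Within G r (f (a + m)) (f b)) a+m+[d∸m]≡a+d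
                     (Within-stride m f edge r (a + m) (suc d ∸ m) d∸m≤m*r))
    where
    a+m+[d∸m]≡a+d : a + m + (suc d ∸ m) ≡ a + suc d
    a+m+[d∸m]≡a+d = trans (+-assoc a m _) (cong (λ e → a + e) (m+[n∸m]≡n (<⇒≤ (≰⇒> d≮m))))
    d∸m≤m*r : suc d ∸ m ≤ m * r
    d∸m≤m*r = subst (suc d ∸ m ≤_) (trans (cong (_∸ m) (*-suc m r)) (m+n∸m≡n m (m * r))) (∸-monoˡ-≤ m d<m*[1+r])

first-crossing : ∀ (f : ℕ → ℕ) {t} k → f 0 < t → t ≤ f k → ∃[ c ] c < k × f c < t × t ≤ f (suc c)
first-crossing f zero f0<t t≤f0 = contradiction t≤f0 (<⇒≱ f0<t)
first-crossing f {t} (suc k) f0<t t≤f[1+k] with t ≤? f k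
... | no t≰fk  = k , ≤-refl , ≰⇒> t≰fk , t≤f[1+k]
... | yes t≤fk with first-crossing f k f0<t t≤fk
...   | c , c<k , crossing = c , m<n⇒m<1+n c<k , crossing

2*m*r≡m*r+m*r : ∀ m r → 2 * m * r ≡ m * r + m * r
2*m*r≡m*r+m*r = ℕ-Solver.solve-∀

module _ (m : ℕ) where

  burnCapacity : ℕ → ℕ
  burnCapacity zero    = 0
  burnCapacity (suc k) = burnCapacity k + suc (2 * m * k)

  burnCapacity-mono : ∀ {k l} → k ≤ l → burnCapacity k ≤ burnCapacity l
  burnCapacity-mono {l = zero} z≤n = ≤-refl
  burnCapacity-mono {l = suc l} k≤1+l with m≤n⇒m<n∨m≡n k≤1+l
  ... | inj₁ k<1+l = ≤-trans (burnCapacity-mono (s≤s⁻¹ k<1+l)) (m≤m+n _ _)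
  ... | inj₂ refl  = ≤-refl

  k≤burnCapacity : ∀ k → k ≤ burnCapacity k
  k≤burnCapacity zero    = z≤n
  k≤burnCapacity (suc k) = ≤-<-trans (k≤burnCapacity k) (m<m+n (burnCapacity k) z<s)

  burnCapacity-interval-unique : ∀ {r r′ v} →
    burnCapacity r ≤ v → v < burnCapacity (suc r) →
    burnCapacity r′ ≤ v → v < burnCapacity (suc r′) → r ≡ r′
  burnCapacity-interval-unique {r} {r′} lo hi lo′ hi′ with <-cmp r r′
  ... | tri< r<r′ _ _ = contradiction (≤-trans (burnCapacity-mono r<r′) lo′) (<⇒≱ hi)
  ... | tri≈ _ r≡r′ _ = r≡r′
  ... | tri> _ _ r′<r = contradiction (≤-trans (burnCapacity-mono r′<r) lo) (<⇒≱ hi′)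

  -- Its ball of radius r in C(n; 1, …, m) is the interval [F r, F (r + 1)).
  ballCentre : ℕ → ℕ
  ballCentre r = burnCapacity r + m * r

∈-oneTo : ∀ {m s} → 0 < s → s ≤ m → s ∈ oneTo m
∈-oneTo {s = suc t} _ t<m = ∈-map⁺ suc (∈-upTo⁺ t<m)

∈-oneTo⁻ : ∀ {m s} → s ∈ oneTo m → s ≤ m
∈-oneTo⁻ s∈ with ∈-map⁻ suc s∈
... | _ , t∈ , refl = ∈-upTo⁻ t∈

module _ {n : ℕ} .{{_ : NonZero n}} {S : List ℕ} {m : ℕ} (S≤m : ∀ {s} → s ∈ S → s ≤ m) where

  edge-displacement : ∀ {x z} → circulant n S x z →
    ∃[ t ] t ≤ m + m × (toℕ z + m) % n ≡ (toℕ x + t) % n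
  edge-displacement {x} {z} e with circulant-edge e
  ... | s , s∈S , inj₁ x≡z+s =
    m ∸ s , ≤-trans (m∸n≤m m s) (m≤m+n m m) ,
    trans (%-congˡ (sym z+m≡z+s+[m∸s])) (%≡-+ʳ (m ∸ s) (sym x≡z+s))
    where
    z+m≡z+s+[m∸s] : toℕ z + s + (m ∸ s) ≡ toℕ z + m
    z+m≡z+s+[m∸s] = trans (+-assoc (toℕ z) s _) (cong (λ u → toℕ z + u) (m+[n∸m]≡n (S≤m s∈S)))
  ... | s , s∈S , inj₂ x+s≡z =
    s + m , +-monoˡ-≤ m (S≤m s∈S) ,
    trans (%≡-+ʳ m (sym x+s≡z)) (%-congˡ (+-assoc (toℕ x) s m))

  -- y ≡ x + (o − mr): the displacement o − mr ∈ [−mr, mr] is shifted to stay in ℕ.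
  walk-displacement : ∀ {r x y} → Within (circulant n S) r x y →
    ∃[ o ] o ≤ 2 * m * r × (m * r + toℕ y) % n ≡ (toℕ x + o) % n
  walk-displacement {r} {x} here =
    m * r , subst (m * r ≤_) (sym (2*m*r≡m*r+m*r m r)) (m≤m+n _ _) , %-congˡ (+-comm (m * r) (toℕ x))
  walk-displacement {suc r} {x} {y} (step {z = z} e w)
    with edge-displacement e | walk-displacement w
  ... | t , t≤ , z+m≡x+t | o , o≤ , y≡z+o = t + o , bound , (begin
    (m * suc r + toℕ y) % n     ≡⟨ %-congˡ (trans (cong (_+ toℕ y) (*-suc m r)) (+-assoc m (m * r) (toℕ y))) ⟩
    (m + (m * r + toℕ y)) % n   ≡⟨ %≡-+ˡ m y≡z+o ⟩
    (m + (toℕ z + o)) % n       ≡⟨ %-congˡ (trans (sym (+-assoc m (toℕ z) o)) (cong (_+ o) (+-comm m (toℕ z)))) ⟩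
    (toℕ z + m + o) % n         ≡⟨ %≡-+ʳ o z+m≡x+t ⟩
    (toℕ x + t + o) % n         ≡⟨ %-congˡ (+-assoc (toℕ x) t o) ⟩
    (toℕ x + (t + o)) % n       ∎)
    where
    open ≡-Reasoning
    bound : t + o ≤ 2 * m * suc r
    bound = subst (t + o ≤_) (sym (2*m*[1+r]≡m+m+2*m*r m r)) (+-mono-≤ t≤ o≤)
      where
      2*m*[1+r]≡m+m+2*m*r : ∀ m r → 2 * m * suc r ≡ m + m + 2 * m * r
      2*m*[1+r]≡m+m+2*m*r = ℕ-Solver.solve-∀

  -- v ↦ F(radius v) + offset v embeds the vertices into [0, F k).
  burning-lower-bound : ∀ {k xs} → IsBurningSeq (circulant n S) k xs → n ≤ burnCapacity m k
  burning-lower-bound {k} {xs} burning = injective⇒≤ {f = λ v → fromℕ< (code<capacity v)} λ eq →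
    same-code⇒≡ (trans (sym (toℕ-fromℕ< _)) (trans (cong toℕ eq) (toℕ-fromℕ< _)))
    where
    source : Fin n → Fin k
    source v = proj₁ (burning v)
    radius : Fin n → ℕ
    radius v = toℕ (opposite (source v))
    displacement : ∀ v → ∃[ o ] o ≤ 2 * m * radius v × (m * radius v + toℕ v) % n ≡ (toℕ (xs (source v)) + o) % n
    displacement v = walk-displacement
      (subst (λ ℓ → Within (circulant n S) ℓ (xs (source v)) v) (sym (opposite-prop (source v))) (proj₂ (burning v)))
    offset : Fin n → ℕ
    offset v = proj₁ (displacement v)
    code : Fin n → ℕ
    code v = burnCapacity m (radius v) + offset v
    code<next : ∀ v → code v < burnCapacity m (suc (radius v))
    code<next v = +-monoʳ-< (burnCapacity m (radius v)) (s≤s (proj₁ (proj₂ (displacement v))))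
    code<capacity : ∀ v → code v < burnCapacity m k
    code<capacity v = <-≤-trans (code<next v) (burnCapacity-mono m (toℕ<n (opposite (source v))))
    same-code⇒≡ : ∀ {v w} → code v ≡ code w → v ≡ w
    same-code⇒≡ {v} {w} eq = toℕ-%-injective (%≡-cancelˡ-+ (m * radius v) (begin
      (m * radius v + toℕ v) % n            ≡⟨ proj₂ (proj₂ (displacement v)) ⟩
      (toℕ (xs (source v)) + offset v) % n  ≡⟨ cong₂ (λ i o → (toℕ (xs i) + o) % n) source≡ offset≡ ⟩
      (toℕ (xs (source w)) + offset w) % n  ≡⟨ proj₂ (proj₂ (displacement w)) ⟨
      (m * radius w + toℕ w) % n            ≡⟨ cong (λ r → (m * r + toℕ w) % n) radius≡ ⟨
      (m * radius v + toℕ w) % n            ∎))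
      where
      open ≡-Reasoning
      radius≡ : radius v ≡ radius w
      radius≡ = burnCapacity-interval-unique m (m≤m+n _ _) (code<next v)
        (subst (burnCapacity m (radius w) ≤_) (sym eq) (m≤m+n _ _)) (subst (_< burnCapacity m (suc (radius w))) (sym eq) (code<next w))
      offset≡ : offset v ≡ offset w
      offset≡ = +-cancelˡ-≡ (burnCapacity m (radius w)) _ _ (subst (λ r → burnCapacity m r + offset v ≡ code w) radius≡ eq)
      source≡ : source v ≡ source w
      source≡ = trans (sym (opposite-involutive (source v)))
        (trans (cong opposite (toℕ-injective radius≡)) (opposite-involutive (source w)))

module _ {n : ℕ} .{{_ : NonZero n}} (m : ℕ) .{{_ : NonZero m}} (m<n : m < n) where

  private
    G : Graph n
    G = circulant n (oneTo m)

  circulant-walk : ∀ r a d → d ≤ m * r → Within G r (a mod n) ((a + d) mod n)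
  circulant-walk = Within-stride m (λ a → a mod n)
    λ a s 0<s s≤m → circulant-stride a (∈-oneTo 0<s s≤m) 0<s (≤-<-trans s≤m m<n)

  ball-covers : ∀ {r v} → burnCapacity m r ≤ v → v < burnCapacity m (suc r) →
    Within G r (ballCentre m r mod n) (v mod n)
  ball-covers {r} {v} lo hi with ballCentre m r ≤? v
  ... | yes c≤v = subst (λ u → Within G r (ballCentre m r mod n) (u mod n)) (m+[n∸m]≡n c≤v)
                    (circulant-walk r (ballCentre m r) (v ∸ ballCentre m r) v∸c≤m*r)
    where
    v≤c+m*r : v ≤ ballCentre m r + m * r
    v≤c+m*r = subst (v ≤_) (trans (cong (_+_ (burnCapacity m r)) (2*m*r≡m*r+m*r m r)) (sym (+-assoc (burnCapacity m r) (m * r) (m * r))))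
                (s≤s⁻¹ (subst (suc v ≤_) (+-suc _ _) hi))
    v∸c≤m*r : v ∸ ballCentre m r ≤ m * r
    v∸c≤m*r = subst (v ∸ ballCentre m r ≤_) (m+n∸m≡n (ballCentre m r) (m * r)) (∸-monoˡ-≤ (ballCentre m r) v≤c+m*r)
  ... | no c≰v = Within-reverse circulant-sym
                   (subst (λ u → Within G r (v mod n) (u mod n)) (m+[n∸m]≡n (<⇒≤ (≰⇒> c≰v)))
                     (circulant-walk r v (ballCentre m r ∸ v) c∸v≤m*r))
    where
    c∸v≤m*r : ballCentre m r ∸ v ≤ m * r
    c∸v≤m*r = subst (ballCentre m r ∸ v ≤_) (m+n∸m≡n (burnCapacity m r) (m * r)) (∸-monoʳ-≤ (ballCentre m r) lo)

  centres : ∀ k → Fin k → Fin n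
  centres k i = ballCentre m (toℕ (opposite i)) mod n

  burning-upper-bound : ∀ k → n ≤ burnCapacity m k → IsBurningSeq G k (centres k)
  burning-upper-bound k n≤F v
    with first-crossing (burnCapacity m) k (z<s {toℕ v}) (<-≤-trans (toℕ<n v) n≤F)
  ... | r , r<k , below , above = i , subst (λ ℓ → Within G ℓ (centres k i) v) (opposite-prop i) covered
    where
    i : Fin k
    i = opposite (fromℕ< r<k)
    radius≡r : toℕ (opposite i) ≡ r
    radius≡r = trans (cong toℕ (opposite-involutive _)) (toℕ-fromℕ< r<k)
    covered : Within G (toℕ (opposite i)) (centres k i) v
    covered = subst (λ ρ → Within G ρ (ballCentre m ρ mod n) v) (sym radius≡r)
                (subst (Within G r (ballCentre m r mod n)) (mod-toℕ v) (ball-covers (s≤s⁻¹ below) above))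

burnCapacity-closed : ∀ p c → burnCapacity (suc p) c + p * c ≡ suc p * c * c
burnCapacity-closed p zero    = trans (*-zeroʳ p) (sym (*-zeroʳ (suc p * 0)))
burnCapacity-closed p (suc c) = begin
  burnCapacity m c + suc (2 * m * c) + p * suc c ≡⟨ regroup (burnCapacity m c) p c ⟩
  (burnCapacity m c + p * c) + suc (2 * m * c + p) ≡⟨ cong (_+ suc (2 * m * c + p)) (burnCapacity-closed p c) ⟩
  m * c * c + suc (2 * m * c + p)                 ≡⟨ expand p c ⟩
  m * suc c * suc c                               ∎
  where
  open ≡-Reasoning
  m = suc p
  regroup : ∀ F p c → F + suc (2 * suc p * c) + p * suc c ≡ (F + p * c) + suc (2 * suc p * c + p)
  regroup = ℕ-Solver.solve-∀
  expand : ∀ p c → suc p * c * c + suc (2 * suc p * c + p) ≡ suc p * suc c * suc c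
  expand = ℕ-Solver.solve-∀

square-identity : ∀ p c →
  (+ (2 * suc p) ℤ.* + c ℤ.- + p) ℤ.* (+ (2 * suc p) ℤ.* + c ℤ.- + p)
    ≡ + (4 * suc p * burnCapacity (suc p) c) ℤ.+ + p ℤ.* + p
square-identity p c = begin
  (+ (2 * m) ℤ.* C ℤ.- P) ℤ.* (+ (2 * m) ℤ.* C ℤ.- P)
    ≡⟨ cong (λ t → (t ℤ.* C ℤ.- P) ℤ.* (t ℤ.* C ℤ.- P)) (ℤₚ.pos-* 2 m) ⟩
  (+ 2 ℤ.* M ℤ.* C ℤ.- P) ℤ.* (+ 2 ℤ.* M ℤ.* C ℤ.- P)
    ≡⟨ expand M C P ⟩
  + 4 ℤ.* M ℤ.* (M ℤ.* C ℤ.* C) ℤ.- + 4 ℤ.* M ℤ.* (P ℤ.* C) ℤ.+ P ℤ.* P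
    ≡⟨ cong (λ t → + 4 ℤ.* M ℤ.* t ℤ.- + 4 ℤ.* M ℤ.* (P ℤ.* C) ℤ.+ P ℤ.* P) (sym closed) ⟩
  + 4 ℤ.* M ℤ.* (X ℤ.+ P ℤ.* C) ℤ.- + 4 ℤ.* M ℤ.* (P ℤ.* C) ℤ.+ P ℤ.* P
    ≡⟨ collapse M C P X ⟩
  + 4 ℤ.* M ℤ.* X ℤ.+ P ℤ.* P
    ≡⟨ cong (ℤ._+ P ℤ.* P) (sym (trans (ℤₚ.pos-* (4 * m) _) (cong (ℤ._* X) (ℤₚ.pos-* 4 m)))) ⟩
  + (4 * m * burnCapacity m c) ℤ.+ P ℤ.* P ∎
  where
  open ≡-Reasoning
  m = suc p
  M C P X : ℤ.ℤ
  M = + m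
  C = + c
  P = + p
  X = + burnCapacity m c
  closed : X ℤ.+ P ℤ.* C ≡ M ℤ.* C ℤ.* C
  closed = begin
    X ℤ.+ P ℤ.* C          ≡⟨ cong (ℤ._+_ X) (ℤₚ.pos-* p c) ⟨
    X ℤ.+ + (p * c)        ≡⟨ ℤₚ.pos-+ (burnCapacity m c) (p * c) ⟨
    + (burnCapacity m c + p * c) ≡⟨ cong +_ (burnCapacity-closed p c) ⟩
    + (m * c * c)          ≡⟨ ℤₚ.pos-* (m * c) c ⟩
    + (m * c) ℤ.* C        ≡⟨ cong (ℤ._* C) (ℤₚ.pos-* m c) ⟩
    M ℤ.* C ℤ.* C          ∎
  expand : ∀ M C P → (+ 2 ℤ.* M ℤ.* C ℤ.- P) ℤ.* (+ 2 ℤ.* M ℤ.* C ℤ.- P)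
    ≡ + 4 ℤ.* M ℤ.* (M ℤ.* C ℤ.* C) ℤ.- + 4 ℤ.* M ℤ.* (P ℤ.* C) ℤ.+ P ℤ.* P
  expand = ℤ-Solver.solve-∀
  collapse : ∀ M C P X → + 4 ℤ.* M ℤ.* (X ℤ.+ P ℤ.* C) ℤ.- + 4 ℤ.* M ℤ.* (P ℤ.* C) ℤ.+ P ℤ.* P
    ≡ + 4 ℤ.* M ℤ.* X ℤ.+ P ℤ.* P
  collapse = ℤ-Solver.solve-∀

isCeilFormula-crossing : ∀ p {n} c → burnCapacity (suc p) c < n → n ≤ burnCapacity (suc p) (suc c) →
  IsCeilFormula (suc p) n (+ suc c)
isCeilFormula-crossing p {n} c below above = inj₂ root-above , (0≤ , root-below)
  where
  m = suc p
  D : ℤ.ℤ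
  D = + (4 * m * n) ℤ.+ + p ℤ.* + p
  root-above : (+ (2 * m) ℤ.* + c ℤ.- + p) ℤ.* (+ (2 * m) ℤ.* + c ℤ.- + p) ℤ.< D
  root-above = subst (ℤ._< D) (sym (square-identity p c))
    (ℤₚ.+-monoˡ-< (+ p ℤ.* + p) (ℤ.+<+ (*-monoʳ-< (4 * m) below)))
  root-below : D ℤ.≤ (+ (2 * m) ℤ.* + suc c ℤ.- + p) ℤ.* (+ (2 * m) ℤ.* + suc c ℤ.- + p)
  root-below = subst (D ℤ.≤_) (sym (square-identity p (suc c)))
    (ℤₚ.+-monoˡ-≤ (+ p ℤ.* + p) (ℤ.+≤+ (*-monoʳ-≤ (4 * m) above)))
  0≤ : + 0 ℤ.≤ + (2 * m) ℤ.* + suc c ℤ.- + p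
  0≤ = ℤₚ.i≤j⇒0≤j-i (subst (+ p ℤ.≤_) (ℤₚ.pos-* (2 * m) (suc c))
    (ℤ.+≤+ (≤-trans (n≤1+n p) (≤-trans (m≤m+n m _) (m≤m*n (2 * m) (suc c))))))

mainTheorem13 : ∀ (m n : ℕ) → 2 ≤ m → 2 * m < n →
    ∃[ b ] IsBurningNumber (circulant n (oneTo m)) b × IsCeilFormula m n (+ b)
mainTheorem13 (suc p) zero _ ()
mainTheorem13 m@(suc p) n@(suc _) _ 2m<n
  with first-crossing (burnCapacity m) n z<s (k≤burnCapacity m n)
... | c , _ , below , above =
  suc c , ((centres m m<n (suc c) , burning-upper-bound m m<n (suc c) above) , minimal) ,
  isCeilFormula-crossing p c below above
  where
  m<n : m < n
  m<n = ≤-<-trans (m≤m+n m _) 2m<n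
  minimal : ∀ k xs → IsBurningSeq (circulant n (oneTo m)) k xs → suc c ≤ k
  minimal k xs burning = ≮⇒≥ λ k<1+c →
    <⇒≱ below (≤-trans (burning-lower-bound ∈-oneTo⁻ burning) (burnCapacity-mono m (s≤s⁻¹ k<1+c)))
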